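{- Let $\vec G=(G_0,\dots,G_n)$ be a constant wfgv. Then there is a term $Z$ such that $Y\vec G=Z$ for every wfpc $Y$; consequently $Z$ is a wfpc. If moreover $\vec G$ is a constant fgv, then this $Z$ is an fpc.
   Context: Untyped $\lambda$-calculus; $=$ denotes $\beta$-conversion. For a finite sequence $\vec G=(G_0,\dots,G_n)$, $M\vec G=MG_0\cdots G_n$; $F^k(z)=F(F(\cdots F(z)\cdots))$ with $k$ copies of $F$. $M=^\infty N$ means $M$ and $N$ have the same Böhm tree. $Y$ is a fixed point combinator (fpc) if $Yx=x(Yx)$ for $x$ not free in $Y$; a weak fpc (wfpc) if $Yx=^\infty x(Yx)$. $\vec G$ is an fgv if $Y$ fpc implies $Y\vec G$ fpc, and a wfgv if $Y$ wfpc implies $Y\vec G$ wfpc. For a term $M$ and variable $z$, write $z\notin M$ if there is $N=M$ with $z$ not free in $N$. A wfgv $\vec G$ is constant if, for a variable $z$ not free in $\vec G$, there is $k\ge0$ with $z\notin G_0^k(z)G_1\cdots G_n$. -}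

module Defs where

open import Data.Nat using (ℕ; zero; suc)
open import Data.List using (List; []; _∷_; map; foldl)
open import Data.List.Relation.Binary.Pointwise using (Pointwise)
open import Data.Product using (Σ; _×_; ∃)
open import Data.Sum using (_⊎_)
open import Data.Unit using (⊤)
open import Relation.Nullary using (¬_)
open import Relation.Binary.PropositionalEquality using (_≡_)

data Term : Set where
  var : ℕ → Term
  _·_ : Term → Term → Term
  ƛ_  : Term → Term

infixl 7 _·_

ext : (ℕ → ℕ) → ℕ → ℕ
ext ρ zero    = zero
ext ρ (suc i) = suc (ρ i)

rename : (ℕ → ℕ) → Term → Term
rename ρ (var i) = var (ρ i)
rename ρ (M · N) = rename ρ M · rename ρ N
rename ρ (ƛ M)   = ƛ rename (ext ρ) M

shift : Term → Term
shift = rename suc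

exts : (ℕ → Term) → ℕ → Term
exts σ zero    = var zero
exts σ (suc i) = shift (σ i)

subst : (ℕ → Term) → Term → Term
subst σ (var i) = σ i
subst σ (M · N) = subst σ M · subst σ N
subst σ (ƛ M)   = ƛ subst (exts σ) M

σ₀ : Term → ℕ → Term
σ₀ N zero    = N
σ₀ N (suc i) = var i

data _→β_ : Term → Term → Set where
  β    : ∀ {M N} → (ƛ M) · N →β subst (σ₀ N) M
  appL : ∀ {M M' N} → M →β M' → M · N →β M' · N
  appR : ∀ {M N N'} → N →β N' → M · N →β M · N'
  lam  : ∀ {M M'} → M →β M' → ƛ M →β ƛ M'

data _=β_ : Term → Term → Set where
  step  : ∀ {M N} → M →β N → M =β N
  refl  : ∀ {M} → M =β M
  sym   : ∀ {M N} → M =β N → N =β M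
  trans : ∀ {M N P} → M =β N → N =β P → M =β P

infix 4 _=β_ _→β_ _=∞_

occurs : ℕ → Term → Set
occurs i (var j) = i ≡ j
occurs i (M · N) = occurs i M ⊎ occurs i N
occurs i (ƛ M)   = occurs (suc i) M

_∉_ : ℕ → Term → Set
z ∉ M = Σ Term λ N → (M =β N) × ¬ occurs z N

_·*_ : Term → List Term → Term
M ·* Gs = foldl _·_ M Gs

lams : ℕ → Term → Term
lams zero    M = M
lams (suc n) M = ƛ lams n M

pow : Term → ℕ → Term → Term
pow F zero    z = z
pow F (suc k) z = F · pow F k z

-- Böhm-tree equality up to depth k: whenever one side has a head
-- normal form λx₁…xₙ.y M₁…Mₘ, the other has a hnf λx₁…xₙ.y N₁…Nₘ
-- with Mᵢ, Nᵢ equal up to depth k-1 (and symmetrically).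
BTeq : ℕ → Term → Term → Set
BTeq zero    M N = ⊤
BTeq (suc k) M N =
  (∀ n y Ms → M =β lams n (var y ·* Ms) →
     Σ (List Term) λ Ns → (N =β lams n (var y ·* Ns)) × Pointwise (BTeq k) Ms Ns)
  × (∀ n y Ns → N =β lams n (var y ·* Ns) →
     Σ (List Term) λ Ms → (M =β lams n (var y ·* Ms)) × Pointwise (BTeq k) Ms Ns)

_=∞_ : Term → Term → Set
M =∞ N = ∀ k → BTeq k M N

-- Y x = x (Y x) with x = var 0 fresh (Y shifted).
FPC : Term → Set
FPC Y = shift Y · var 0 =β var 0 · (shift Y · var 0)

WFPC : Term → Set
WFPC Y = shift Y · var 0 =∞ var 0 · (shift Y · var 0)

FGV : Term → List Term → Set
FGV G₀ Gs = ∀ Y → FPC Y → FPC (Y ·* (G₀ ∷ Gs))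

WFGV : Term → List Term → Set
WFGV G₀ Gs = ∀ Y → WFPC Y → WFPC (Y ·* (G₀ ∷ Gs))

-- constancy: z = var 0 fresh for the shifted G⃗;
-- ∃ k. z ∉ G₀^k(z) G₁ ⋯ Gₙ
Constant : Term → List Term → Set
Constant G₀ Gs = ∃ λ k → 0 ∉ (pow (shift G₀) k (var 0) ·* map shift Gs)

-- A weak fixed point combinator satisfies Y x =∞ x (Y x), and reading off the
-- Böhm tree k levels deep gives Y x = x^k(C) for some C; instantiating x by G₀
-- yields Y G₀ = G₀^k(P). Hence Y G⃗ = (G₀^k(z) G₁ ⋯ Gₙ)[z := P], which by
-- constancy is convertible to a term not mentioning z, so its value Z does not
-- depend on P, nor on Y. Taking Y to be Curry's fixed point combinator Θ, the
-- generating vector makes Θ G⃗ = Z a (weak) fixed point combinator.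
module Submission where

open import Defs
open import Data.Nat using (zero; suc)
open import Data.List using (List; []; _∷_; map)
open import Data.List.Relation.Binary.Pointwise using ([]; _∷_)
  renaming (refl to Pointwise-refl)
open import Data.Product using (Σ; _×_; _,_)
open import Data.Sum using (inj₁; inj₂)
open import Data.Empty using (⊥-elim)
open import Data.Unit using (tt)
open import Relation.Nullary using (¬_)
open import Relation.Binary.Bundles using (Setoid)
open import Relation.Binary.PropositionalEquality as Eq using (_≡_; cong; cong₂)

rename-cong : ∀ {ρ ρ'} → (∀ i → ρ i ≡ ρ' i) → ∀ M → rename ρ M ≡ rename ρ' M
rename-cong ρ≗ρ' (var i) = cong var (ρ≗ρ' i)
rename-cong ρ≗ρ' (M · N) = cong₂ _·_ (rename-cong ρ≗ρ' M) (rename-cong ρ≗ρ' N)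
rename-cong {ρ} {ρ'} ρ≗ρ' (ƛ M) = cong ƛ_ (rename-cong ext-cong M)
  where
  ext-cong : ∀ i → ext ρ i ≡ ext ρ' i
  ext-cong zero    = Eq.refl
  ext-cong (suc i) = cong suc (ρ≗ρ' i)

subst-cong : ∀ {σ τ} → (∀ i → σ i ≡ τ i) → ∀ M → subst σ M ≡ subst τ M
subst-cong σ≗τ (var i) = σ≗τ i
subst-cong σ≗τ (M · N) = cong₂ _·_ (subst-cong σ≗τ M) (subst-cong σ≗τ N)
subst-cong {σ} {τ} σ≗τ (ƛ M) = cong ƛ_ (subst-cong exts-cong M)
  where
  exts-cong : ∀ i → exts σ i ≡ exts τ i
  exts-cong zero    = Eq.refl
  exts-cong (suc i) = cong shift (σ≗τ i)

subst-cong-occurs : ∀ {σ τ} M → (∀ i → occurs i M → σ i ≡ τ i) → subst σ M ≡ subst τ M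
subst-cong-occurs (var j) σ≗τ = σ≗τ j Eq.refl
subst-cong-occurs (M · N) σ≗τ =
  cong₂ _·_ (subst-cong-occurs M (λ i o → σ≗τ i (inj₁ o)))
            (subst-cong-occurs N (λ i o → σ≗τ i (inj₂ o)))
subst-cong-occurs {σ} {τ} (ƛ M) σ≗τ = cong ƛ_ (subst-cong-occurs M exts-cong)
  where
  exts-cong : ∀ i → occurs i M → exts σ i ≡ exts τ i
  exts-cong zero    _ = Eq.refl
  exts-cong (suc i) o = cong shift (σ≗τ i o)

rename-rename : ∀ ρ ρ' M → rename ρ (rename ρ' M) ≡ rename (λ i → ρ (ρ' i)) M
rename-rename ρ ρ' (var i) = Eq.refl
rename-rename ρ ρ' (M · N) = cong₂ _·_ (rename-rename ρ ρ' M) (rename-rename ρ ρ' N)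
rename-rename ρ ρ' (ƛ M)   =
  cong ƛ_ (Eq.trans (rename-rename (ext ρ) (ext ρ') M) (rename-cong ext-∘ M))
  where
  ext-∘ : ∀ i → ext ρ (ext ρ' i) ≡ ext (λ j → ρ (ρ' j)) i
  ext-∘ zero    = Eq.refl
  ext-∘ (suc i) = Eq.refl

subst-rename : ∀ σ ρ M → subst σ (rename ρ M) ≡ subst (λ i → σ (ρ i)) M
subst-rename σ ρ (var i) = Eq.refl
subst-rename σ ρ (M · N) = cong₂ _·_ (subst-rename σ ρ M) (subst-rename σ ρ N)
subst-rename σ ρ (ƛ M)   =
  cong ƛ_ (Eq.trans (subst-rename (exts σ) (ext ρ) M) (subst-cong exts-ext M))
  where
  exts-ext : ∀ i → exts σ (ext ρ i) ≡ exts (λ j → σ (ρ j)) i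
  exts-ext zero    = Eq.refl
  exts-ext (suc i) = Eq.refl

rename-subst : ∀ ρ σ M → rename ρ (subst σ M) ≡ subst (λ i → rename ρ (σ i)) M
rename-subst ρ σ (var i) = Eq.refl
rename-subst ρ σ (M · N) = cong₂ _·_ (rename-subst ρ σ M) (rename-subst ρ σ N)
rename-subst ρ σ (ƛ M)   =
  cong ƛ_ (Eq.trans (rename-subst (ext ρ) (exts σ) M) (subst-cong ext-exts M))
  where
  ext-exts : ∀ i → rename (ext ρ) (exts σ i) ≡ exts (λ j → rename ρ (σ j)) i
  ext-exts zero    = Eq.refl
  ext-exts (suc i) = Eq.trans (rename-rename (ext ρ) suc (σ i))
                              (Eq.sym (rename-rename suc ρ (σ i)))

subst-subst : ∀ σ τ M → subst σ (subst τ M) ≡ subst (λ i → subst σ (τ i)) M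
subst-subst σ τ (var i) = Eq.refl
subst-subst σ τ (M · N) = cong₂ _·_ (subst-subst σ τ M) (subst-subst σ τ N)
subst-subst σ τ (ƛ M)   =
  cong ƛ_ (Eq.trans (subst-subst (exts σ) (exts τ) M) (subst-cong exts-exts M))
  where
  exts-exts : ∀ i → subst (exts σ) (exts τ i) ≡ exts (λ j → subst σ (τ j)) i
  exts-exts zero    = Eq.refl
  exts-exts (suc i) = Eq.trans (subst-rename (exts σ) suc (τ i))
                               (Eq.sym (rename-subst suc σ (τ i)))

subst-var : ∀ M → subst var M ≡ M
subst-var (var i) = Eq.refl
subst-var (M · N) = cong₂ _·_ (subst-var M) (subst-var N)
subst-var (ƛ M)   = cong ƛ_ (Eq.trans (subst-cong exts-var M) (subst-var M))
  where
  exts-var : ∀ i → exts var i ≡ var i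
  exts-var zero    = Eq.refl
  exts-var (suc i) = Eq.refl

rename-as-subst : ∀ ρ M → rename ρ M ≡ subst (λ i → var (ρ i)) M
rename-as-subst ρ M = Eq.trans (Eq.sym (subst-var (rename ρ M))) (subst-rename var ρ M)

subst-σ₀-shift : ∀ N M → subst (σ₀ N) (shift M) ≡ M
subst-σ₀-shift N M = Eq.trans (subst-rename (σ₀ N) suc M) (subst-var M)

subst-σ₀-commute : ∀ σ N M →
  subst σ (subst (σ₀ N) M) ≡ subst (σ₀ (subst σ N)) (subst (exts σ) M)
subst-σ₀-commute σ N M =
  Eq.trans (subst-subst σ (σ₀ N) M)
    (Eq.trans (subst-cong σ∘σ₀ M) (Eq.sym (subst-subst (σ₀ (subst σ N)) (exts σ) M)))
  where
  σ∘σ₀ : ∀ i → subst σ (σ₀ N i) ≡ subst (σ₀ (subst σ N)) (exts σ i)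
  σ∘σ₀ zero    = Eq.refl
  σ∘σ₀ (suc i) = Eq.sym (subst-σ₀-shift (subst σ N) (σ i))

subst-·* : ∀ σ M Gs → subst σ (M ·* Gs) ≡ subst σ M ·* map (subst σ) Gs
subst-·* σ M []       = Eq.refl
subst-·* σ M (G ∷ Gs) = subst-·* σ (M · G) Gs

subst-pow : ∀ σ F k z → subst σ (pow F k z) ≡ pow (subst σ F) k (subst σ z)
subst-pow σ F zero    z = Eq.refl
subst-pow σ F (suc k) z = cong (subst σ F ·_) (subst-pow σ F k z)

map-subst-σ₀-shift : ∀ P Gs → map (subst (σ₀ P)) (map shift Gs) ≡ Gs
map-subst-σ₀-shift P []       = Eq.refl
map-subst-σ₀-shift P (G ∷ Gs) = cong₂ _∷_ (subst-σ₀-shift P G) (map-subst-σ₀-shift P Gs)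

subst-σ₀-pow-·* : ∀ P F k Gs →
  subst (σ₀ P) (pow (shift F) k (var 0) ·* map shift Gs) ≡ pow F k P ·* Gs
subst-σ₀-pow-·* P F k Gs =
  Eq.trans (subst-·* (σ₀ P) (pow (shift F) k (var 0)) (map shift Gs))
    (cong₂ _·*_ (Eq.trans (subst-pow (σ₀ P) (shift F) k (var 0))
                          (cong (λ F' → pow F' k P) (subst-σ₀-shift P F)))
                (map-subst-σ₀-shift P Gs))

subst-σ₀-∉ : ∀ P Q N → ¬ occurs 0 N → subst (σ₀ P) N ≡ subst (σ₀ Q) N
subst-σ₀-∉ P Q N 0∉N = subst-cong-occurs N σ₀≗σ₀
  where
  σ₀≗σ₀ : ∀ i → occurs i N → σ₀ P i ≡ σ₀ Q i
  σ₀≗σ₀ zero    o = ⊥-elim (0∉N o)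
  σ₀≗σ₀ (suc i) _ = Eq.refl

=β-setoid : Setoid _ _
=β-setoid = record
  { Carrier       = Term
  ; _≈_           = _=β_
  ; isEquivalence = record { refl = refl ; sym = sym ; trans = trans }
  }

open import Relation.Binary.Reasoning.Setoid =β-setoid

≡⇒=β : ∀ {M N} → M ≡ N → M =β N
≡⇒=β Eq.refl = refl

subst-→β : ∀ σ {M N} → M →β N → subst σ M →β subst σ N
subst-→β σ (β {M} {N}) =
  Eq.subst (subst σ ((ƛ M) · N) →β_) (Eq.sym (subst-σ₀-commute σ N M)) β
subst-→β σ (appL r) = appL (subst-→β σ r)
subst-→β σ (appR r) = appR (subst-→β σ r)
subst-→β σ (lam r)  = lam (subst-→β (exts σ) r)

subst-=β : ∀ σ {M N} → M =β N → subst σ M =β subst σ N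
subst-=β σ (step r)    = step (subst-→β σ r)
subst-=β σ refl        = refl
subst-=β σ (sym p)     = sym (subst-=β σ p)
subst-=β σ (trans p q) = trans (subst-=β σ p) (subst-=β σ q)

shift-=β : ∀ {M N} → M =β N → shift M =β shift N
shift-=β {M} {N} M=N = begin
  shift M                       ≡⟨ rename-as-subst suc M ⟩
  subst (λ i → var (suc i)) M   ≈⟨ subst-=β _ M=N ⟩
  subst (λ i → var (suc i)) N   ≡⟨ Eq.sym (rename-as-subst suc N) ⟩
  shift N                       ∎

·-congˡ : ∀ {M M' N} → M =β M' → M · N =β M' · N
·-congˡ (step r)    = step (appL r)
·-congˡ refl        = refl
·-congˡ (sym p)     = sym (·-congˡ p)
·-congˡ (trans p q) = trans (·-congˡ p) (·-congˡ q)

·-congʳ : ∀ {M N N'} → N =β N' → M · N =β M · N'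
·-congʳ (step r)    = step (appR r)
·-congʳ refl        = refl
·-congʳ (sym p)     = sym (·-congʳ p)
·-congʳ (trans p q) = trans (·-congʳ p) (·-congʳ q)

·*-congˡ : ∀ {M M'} Gs → M =β M' → M ·* Gs =β M' ·* Gs
·*-congˡ []       p = p
·*-congˡ (G ∷ Gs) p = ·*-congˡ Gs (·-congˡ p)

BTeq-refl : ∀ k M → BTeq k M M
BTeq-refl zero    M = tt
BTeq-refl (suc k) M =
  (λ _ _ Ms p → Ms , p , Pointwise-refl (BTeq-refl k _)) ,
  (λ _ _ Ns p → Ns , p , Pointwise-refl (BTeq-refl k _))

BTeq-resp : ∀ k {M M' N N'} → M =β M' → N =β N' → BTeq k M N → BTeq k M' N'
BTeq-resp zero    _    _    _            = tt
BTeq-resp (suc k) M=M' N=N' (fwd , bwd) =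
  (λ n y Ms M'=h → let Ns , N=h , Ms≈Ns = fwd n y Ms (trans M=M' M'=h)
                   in Ns , trans (sym N=N') N=h , Ms≈Ns) ,
  (λ n y Ns N'=h → let Ms , M=h , Ms≈Ns = bwd n y Ns (trans N=N' N'=h)
                   in Ms , trans (sym M=M') M=h , Ms≈Ns)

=β⇒=∞ : ∀ {M N} → M =β N → M =∞ N
=β⇒=∞ {M} M=N k = BTeq-resp k refl M=N (BTeq-refl k M)

=∞-resp-=β : ∀ {M M' N N'} → M =β M' → N =β N' → M =∞ N → M' =∞ N'
=∞-resp-=β M=M' N=N' M=∞N k = BTeq-resp k M=M' N=N' (M=∞N k)

-- Each level of agreement with var x · A exposes one more head occurrence of x.
BTeq-·-unfold : ∀ k {x A} → BTeq k A (var x · A) → Σ Term λ C → A =β pow (var x) k C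
BTeq-·-unfold zero    {A = A} _ = A , refl
BTeq-·-unfold (suc k) {x} {A} (_ , bwd) with bwd 0 x (A ∷ []) refl
... | (B ∷ []) , A=xB , (B≈A ∷ []) with BTeq-·-unfold k (BTeq-resp k refl A=xB B≈A)
... | C , B=xᵏC = C , trans A=xB (·-congʳ B=xᵏC)

FPC-resp-=β : ∀ {Y Y'} → Y =β Y' → FPC Y → FPC Y'
FPC-resp-=β Y=Y' Yx=xYx =
  trans (sym (·-congˡ (shift-=β Y=Y')))
    (trans Yx=xYx (·-congʳ (·-congˡ (shift-=β Y=Y'))))

WFPC-resp-=β : ∀ {Y Y'} → Y =β Y' → WFPC Y → WFPC Y'
WFPC-resp-=β Y=Y' =
  =∞-resp-=β (·-congˡ (shift-=β Y=Y')) (·-congʳ (·-congˡ (shift-=β Y=Y')))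

FPC⇒WFPC : ∀ {Y} → FPC Y → WFPC Y
FPC⇒WFPC = =β⇒=∞

WFPC-·-pow : ∀ {Y} → WFPC Y → ∀ k G → Σ Term λ P → Y · G =β pow G k P
WFPC-·-pow {Y} Yx=∞xYx k G =
  let C , Yx=xᵏC = BTeq-·-unfold k (Yx=∞xYx k) in
  subst (σ₀ G) C , (begin
    Y · G                              ≡⟨ cong (_· G) (Eq.sym (subst-σ₀-shift G Y)) ⟩
    subst (σ₀ G) (shift Y · var 0)     ≈⟨ subst-=β (σ₀ G) Yx=xᵏC ⟩
    subst (σ₀ G) (pow (var 0) k C)     ≡⟨ subst-pow (σ₀ G) (var 0) k C ⟩
    pow G k (subst (σ₀ G) C)           ∎)

Θ : Term
Θ = ƛ ((ƛ (var 1 · (var 0 · var 0))) · (ƛ (var 1 · (var 0 · var 0))))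

Θ-fpc : FPC Θ
Θ-fpc = trans (step β) (trans (step β) (sym (step (appR β))))

-- σ₀ (var 0) only lowers the free indices of N; its value at 0 is never used.
WFPC-·*-constant : ∀ G₀ Gs {k N} →
  pow (shift G₀) k (var 0) ·* map shift Gs =β N → ¬ occurs 0 N →
  ∀ {Y} → WFPC Y → Y ·* (G₀ ∷ Gs) =β subst (σ₀ (var 0)) N
WFPC-·*-constant G₀ Gs {k} {N} E=N 0∉N {Y} wfpc =
  let P , YG₀=G₀ᵏP = WFPC-·-pow wfpc k G₀ in begin
    (Y · G₀) ·* Gs                                          ≈⟨ ·*-congˡ Gs YG₀=G₀ᵏP ⟩
    pow G₀ k P ·* Gs                                        ≡⟨ Eq.sym (subst-σ₀-pow-·* P G₀ k Gs) ⟩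
    subst (σ₀ P) (pow (shift G₀) k (var 0) ·* map shift Gs) ≈⟨ subst-=β (σ₀ P) E=N ⟩
    subst (σ₀ P) N                                          ≡⟨ subst-σ₀-∉ P (var 0) N 0∉N ⟩
    subst (σ₀ (var 0)) N                                    ∎

proposition4p5 : (G₀ : Term) (Gs : List Term) →
    WFGV G₀ Gs → Constant G₀ Gs →
    Σ Term λ Z →
      (∀ Y → WFPC Y → Y ·* (G₀ ∷ Gs) =β Z)
      × WFPC Z
      × (FGV G₀ Gs → FPC Z)
proposition4p5 G₀ Gs wfgv (k , N , E=N , 0∉N) =
  Z , YG⃗=Z , WFPC-resp-=β ΘG⃗=Z (wfgv Θ (FPC⇒WFPC Θ-fpc)) ,
  λ fgv → FPC-resp-=β ΘG⃗=Z (fgv Θ Θ-fpc)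
  where
  Z : Term
  Z = subst (σ₀ (var 0)) N

  YG⃗=Z : ∀ Y → WFPC Y → Y ·* (G₀ ∷ Gs) =β Z
  YG⃗=Z Y = WFPC-·*-constant G₀ Gs E=N 0∉N

  ΘG⃗=Z : Θ ·* (G₀ ∷ Gs) =β Z
  ΘG⃗=Z = YG⃗=Z Θ (FPC⇒WFPC Θ-fpc)
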